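{- Let $a, c$ be nonnegative integers. Then there exists a nonnegative integer $b$ such that $\mathcal{G}_{\mathcal{R}}(a,b) = c$.
   Context: A position is an unordered pair $(a,b)$ of nonnegative integers (pile sizes). $\mathcal{R}$-Wythoff: a move either removes a positive number of tokens from the larger pile (or from either pile if both piles have equal size), or removes the same positive number of tokens from both piles. $\mathcal{G}_{\mathcal{R}}$ is the Sprague-Grundy function of $\mathcal{R}$-Wythoff: $\mathcal{G}_{\mathcal{R}}(p)=\mathrm{mex}\{\mathcal{G}_{\mathcal{R}}(q): q \text{ reachable from } p \text{ in one move}\}$, where $\mathrm{mex}(S)$ is the least nonnegative integer not in $S$ and $\mathrm{mex}\{\}=0$. -}

module Defs where

open import Data.Nat using (ℕ; zero; suc; _+_; _∸_; _≤ᵇ_; _≡ᵇ_; _<ᵇ_)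
open import Data.Bool using (Bool; true; false; if_then_else_; _∨_)
open import Data.List using (List; []; _∷_; _++_; map; length; upTo)
open import Data.Bool.ListAction using (any)
open import Data.Product using (_×_; _,_)

-- A position: pair of pile sizes, read as unordered.
Position : Set
Position = ℕ × ℕ

-- Moves of R-Wythoff from (a , b), listed as concrete pairs.
--  * remove k ≥ 1 tokens from a pile that is the larger one (either pile if equal):
--      from pile 1 allowed iff b ≤ a ; from pile 2 allowed iff a ≤ b
--  * remove k ≥ 1 tokens from both piles (k ≤ min a b).
-- upTo n = [0 , … , n-1], so "n ∸ suc i" ranges over n-1 … 0, i.e. all removals k = i+1.
moves : Position → List Position
moves (a , b) =
  (if b ≤ᵇ a then map (λ i → (a ∸ suc i , b)) (upTo a) else [])
  ++ (if a ≤ᵇ b then map (λ i → (a , b ∸ suc i)) (upTo b) else [])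
  ++ map (λ i → (a ∸ suc i , b ∸ suc i)) (upTo (if a ≤ᵇ b then a else b))

_∈ᵇ_ : ℕ → List ℕ → Bool
n ∈ᵇ l = any (λ m → n ≡ᵇ m) l

-- mex: least natural not in the list (searched among 0 … length l, which suffices)
mexFrom : ℕ → ℕ → List ℕ → ℕ
mexFrom zero n l = n
mexFrom (suc fuel) n l = if n ∈ᵇ l then mexFrom fuel (suc n) l else n

mex : List ℕ → ℕ
mex l = mexFrom (length l) 0 l

-- Sprague–Grundy value of R-Wythoff, by recursion with fuel; every move strictly
-- decreases a + b, so fuel a + b + 1 is sufficient (and the value is then exact).
grundyFuel : ℕ → Position → ℕ
grundyFuel zero p = 0
grundyFuel (suc fuel) p = mex (map (grundyFuel fuel) (moves p))

GR : ℕ → ℕ → ℕ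
GR a b = grundyFuel (suc (a + b)) (a , b)

module Submission where

-- Fix a and c and suppose c is missed at every (a , b) with b ≤ a + 1 + (c + a).  For
-- a < b the options of (a , b) are the positions (a , b') with b' < b and the diagonal
-- positions (a ∸ suc i , b ∸ suc i) with i < a.  Hence each row is injective above the
-- diagonal, and if GR a b > c then c, lying below the mex, is the value of an option; it
-- cannot be (a , b'), where c is missed, so it is a diagonal option.  Thus each of the
-- c + a + 1 columns a < b ≤ a + 1 + (c + a) carries an "excuse": a value GR a b < c, or
-- an index i < a.  Coding excuses into [0 , c + a) is injective (by injectivity of row a,
-- resp. of row a ∸ suc i), which contradicts the pigeonhole principle; a bounded search
-- then yields the witness.

open import Defs
open import Data.Nat using (ℕ; zero; suc; _+_; _∸_; _≤_; _<_; _≤ᵇ_; _≡ᵇ_; _≟_; z≤n; s≤s; s≤s⁻¹)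
open import Data.Nat.Properties
open import Data.Bool using (true; false; if_then_else_; T)
open import Data.List using (List; []; map; length; upTo; lookup)
open import Data.List.Properties using (map-cong-local)
open import Data.List.Membership.Propositional using (_∈_; _∉_)
open import Data.List.Membership.Propositional.Properties using (∈-map⁺; ∈-map⁻; ∈-++⁺ˡ; ∈-++⁺ʳ; ∈-++⁻; ∈-upTo⁺; ∈-upTo⁻)
open import Data.List.Relation.Unary.Any as Any using (index)
open import Data.List.Relation.Unary.Any.Properties using (any⁺; any⁻; lookup-index)
open import Data.List.Relation.Unary.All as All using ()
open import Data.Fin as Fin using (Fin; toℕ; fromℕ<)
open import Data.Fin.Properties using (pigeonhole; toℕ<n; toℕ-fromℕ<; any?)
open import Data.Product using (∃; ∃₂; ∃-syntax; _×_; _,_)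
open import Data.Sum using (_⊎_; inj₁; inj₂)
open import Data.Empty using (⊥; ⊥-elim)
open import Relation.Binary.Definitions using (tri<; tri≈; tri>)
open import Relation.Binary.PropositionalEquality using (_≡_; _≢_; refl; sym; trans; cong; subst)
open import Relation.Nullary using (¬_; yes; no)
open import Relation.Nullary.Reflects using (Reflects; ofʸ; ofⁿ; fromEquivalence)

∈ᵇ-reflects : ∀ n l → Reflects (n ∈ l) (n ∈ᵇ l)
∈ᵇ-reflects n l = fromEquivalence
  (λ h → Any.map (≡ᵇ⇒≡ n _) (any⁻ (n ≡ᵇ_) l h))
  (λ n∈l → any⁺ (n ≡ᵇ_) (Any.map (≡⇒≡ᵇ n _) n∈l))

mexFrom-covers : ∀ f n l {m} → n ≤ m → m < mexFrom f n l → m ∈ l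
mexFrom-covers zero n l n≤m m<r = ⊥-elim (<⇒≱ m<r n≤m)
mexFrom-covers (suc f) n l n≤m m<r with n ∈ᵇ l | ∈ᵇ-reflects n l
... | false | _ = ⊥-elim (<⇒≱ m<r n≤m)
... | true | ofʸ n∈l with m≤n⇒m<n∨m≡n n≤m
...   | inj₁ n<m = mexFrom-covers f (suc n) l n<m m<r
...   | inj₂ refl = n∈l

mexFrom-exit : ∀ f n l → mexFrom f n l ∉ l ⊎ mexFrom f n l ≡ f + n
mexFrom-exit zero n l = inj₂ refl
mexFrom-exit (suc f) n l with n ∈ᵇ l | ∈ᵇ-reflects n l
... | false | ofⁿ n∉l = inj₁ n∉l
... | true | _ with mexFrom-exit f (suc n) l
...   | inj₁ outside = inj₁ outside
...   | inj₂ exhausted = inj₂ (trans exhausted (+-suc f n))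

below-mex : ∀ l {m} → m < mex l → m ∈ l
below-mex l = mexFrom-covers (length l) 0 l z≤n

-- A list of length n cannot contain all of 0 , … , n: their positions would collide.
list-misses : ∀ l → ¬ (∀ m → m ≤ length l → m ∈ l)
list-misses l all∈ = collision (pigeonhole ≤-refl position)
  where
  member : (k : Fin (suc (length l))) → toℕ k ∈ l
  member k = all∈ (toℕ k) (s≤s⁻¹ (toℕ<n k))

  position : Fin (suc (length l)) → Fin (length l)
  position k = index (member k)

  collision : (∃₂ λ i j → i Fin.< j × position i ≡ position j) → ⊥
  collision (i , j , i<j , same) = <-irrefl i≡j i<j
    where
    i≡j : toℕ i ≡ toℕ j
    i≡j = trans (lookup-index (member i)) (trans (cong (lookup l) same) (sym (lookup-index (member j))))

-- The mex of a list does not occur in it (so the fuel in Defs' mex always suffices).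
mex-∉ : ∀ l → mex l ∉ l
mex-∉ l with mexFrom-exit (length l) 0 l
... | inj₁ outside = outside
... | inj₂ exhausted = λ mex∈l → list-misses l (λ m m≤ → covered m m≤ mex∈l)
  where
  mex≡length : mex l ≡ length l
  mex≡length = trans exhausted (+-identityʳ (length l))

  covered : ∀ m → m ≤ length l → mex l ∈ l → m ∈ l
  covered m m≤ mex∈l with m≤n⇒m<n∨m≡n m≤
  ... | inj₁ m< = below-mex l (subst (m <_) (sym mex≡length) m<)
  ... | inj₂ refl = subst (_∈ l) mex≡length mex∈l

data Move (a b : ℕ) : Position → Set where
  from-first  : ∀ {i} → b ≤ a → i < a → Move a b (a ∸ suc i , b)
  from-second : ∀ {i} → a ≤ b → i < b → Move a b (a , b ∸ suc i)
  from-both   : ∀ {i} → i < a → i < b → Move a b (a ∸ suc i , b ∸ suc i)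

∈-guarded⁻ : ∀ {A : Set} {x : A} t xs → x ∈ (if t then xs else []) → T t × x ∈ xs
∈-guarded⁻ true xs x∈ = _ , x∈

∈-guarded⁺ : ∀ {A : Set} {x : A} {t} xs → T t → x ∈ xs → x ∈ (if t then xs else [])
∈-guarded⁺ {t = true} xs _ x∈ = x∈

below-min : ∀ a b {i} → i < (if a ≤ᵇ b then a else b) → i < a × i < b
below-min a b i< with a ≤ᵇ b | ≤ᵇ-reflects-≤ a b
... | true | ofʸ a≤b = i< , <-≤-trans i< a≤b
... | false | ofⁿ a≰b = <-trans i< (≰⇒> a≰b) , i<

∸suc< : ∀ {a i} → i < a → a ∸ suc i < a
∸suc< {suc a} {i} _ = s≤s (m∸n≤m a i)

moves-sound : ∀ {a b q} → q ∈ moves (a , b) → Move a b q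
moves-sound {a} {b} {q} q∈
  with ∈-++⁻ (if b ≤ᵇ a then map (λ i → (a ∸ suc i , b)) (upTo a) else []) q∈
... | inj₁ q∈first =
  let b≤a , q∈map = ∈-guarded⁻ (b ≤ᵇ a) _ q∈first
      i , i∈ , q≡ = ∈-map⁻ (λ i → (a ∸ suc i , b)) q∈map
  in subst (Move a b) (sym q≡) (from-first (≤ᵇ⇒≤ b a b≤a) (∈-upTo⁻ i∈))
... | inj₂ q∈rest with ∈-++⁻ (if a ≤ᵇ b then map (λ i → (a , b ∸ suc i)) (upTo b) else []) q∈rest
...   | inj₁ q∈second =
  let a≤b , q∈map = ∈-guarded⁻ (a ≤ᵇ b) _ q∈second
      i , i∈ , q≡ = ∈-map⁻ (λ i → (a , b ∸ suc i)) q∈map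
  in subst (Move a b) (sym q≡) (from-second (≤ᵇ⇒≤ a b a≤b) (∈-upTo⁻ i∈))
...   | inj₂ q∈both =
  let i , i∈ , q≡ = ∈-map⁻ (λ i → (a ∸ suc i , b ∸ suc i)) q∈both
      i<a , i<b = below-min a b (∈-upTo⁻ i∈)
  in subst (Move a b) (sym q≡) (from-both i<a i<b)

second-option : ∀ {a b b'} → a ≤ b → b' < b → (a , b') ∈ moves (a , b)
second-option {a} {b} {b'} a≤b b'<b =
  ∈-++⁺ʳ (if b ≤ᵇ a then map (λ i → (a ∸ suc i , b)) (upTo a) else [])
    (∈-++⁺ˡ (∈-guarded⁺ _ (≤⇒≤ᵇ a≤b) (subst (λ y → (a , y) ∈ second) (remove-rest b'<b)
      (∈-map⁺ (λ i → (a , b ∸ suc i)) (∈-upTo⁺ (∸suc< b'<b))))))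
  where
  second : List Position
  second = map (λ i → (a , b ∸ suc i)) (upTo b)

  remove-rest : ∀ {n m} → m < n → n ∸ suc (n ∸ suc m) ≡ m
  remove-rest {suc n} (s≤s m≤n) = m∸[m∸n]≡n m≤n

size : Position → ℕ
size (x , y) = x + y

move-decreases : ∀ {a b q} → Move a b q → size q < a + b
move-decreases {b = b} (from-first _ i<a) = +-monoˡ-< b (∸suc< i<a)
move-decreases {a = a} (from-second _ i<b) = +-monoʳ-< a (∸suc< i<b)
move-decreases {b = b} (from-both {i} i<a _) = +-mono-<-≤ (∸suc< i<a) (m∸n≤m b (suc i))

grundy : Position → ℕ
grundy (x , y) = GR x y

grundyFuel-stable : ∀ f g p → size p < f → size p < g → grundyFuel f p ≡ grundyFuel g p
grundyFuel-stable (suc f) (suc g) (a , b) p<f p<g =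
  cong mex (map-cong-local {xs = moves (a , b)} (All.tabulate λ q∈ →
  let q<p = move-decreases (moves-sound {a} {b} q∈)
  in grundyFuel-stable f g _ (<-≤-trans q<p (s≤s⁻¹ p<f)) (<-≤-trans q<p (s≤s⁻¹ p<g))))

GR-unfold : ∀ a b → GR a b ≡ mex (map grundy (moves (a , b)))
GR-unfold a b = cong mex (map-cong-local {xs = moves (a , b)} (All.tabulate λ {q} q∈ →
  grundyFuel-stable (a + b) (suc (size q)) q (move-decreases (moves-sound {a} {b} q∈)) ≤-refl))

option-≢ : ∀ {a b q} → q ∈ moves (a , b) → grundy q ≢ GR a b
option-≢ {a} {b} {q} q∈ q≡ = mex-∉ values (subst (_∈ values) (trans q≡ (GR-unfold a b)) (∈-map⁺ grundy q∈))
  where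
  values : List ℕ
  values = map grundy (moves (a , b))

below-GR : ∀ {a b m} → m < GR a b → ∃[ q ] (q ∈ moves (a , b) × grundy q ≡ m)
below-GR {a} {b} m< =
  let q , q∈ , m≡ = ∈-map⁻ grundy (below-mex _ (subst (_ <_) (GR-unfold a b) m<))
  in q , q∈ , sym m≡

row-distinct : ∀ {a b b'} → a ≤ b → b' < b → GR a b' ≢ GR a b
row-distinct {a} {b} a≤b b'<b = option-≢ {a} {b} (second-option a≤b b'<b)

below-GR-source : ∀ {a b c} → a < b → c < GR a b →
  (∃[ b' ] (b' < b × GR a b' ≡ c)) ⊎ (∃[ i ] (i < a × GR (a ∸ suc i) (b ∸ suc i) ≡ c))
below-GR-source {a} {b} {c} a<b c< = let q , q∈ , q≡ = below-GR {a} {b} c< in source (moves-sound {a} {b} q∈) q≡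
  where
  source : ∀ {q} → Move a b q → grundy q ≡ c →
    (∃[ b' ] (b' < b × GR a b' ≡ c)) ⊎ (∃[ i ] (i < a × GR (a ∸ suc i) (b ∸ suc i) ≡ c))
  source (from-first b≤a _) _ = ⊥-elim (<⇒≱ a<b b≤a)
  source (from-second {i} _ i<b) q≡ = inj₁ (b ∸ suc i , ∸suc< i<b , q≡)
  source (from-both {i} i<a _) q≡ = inj₂ (i , i<a , q≡)

-- Why column b of row a may miss the value c: its entry is smaller than c, or c is
-- the value of the diagonal option removing suc i tokens.
data Excuse (a c b : ℕ) : Set where
  smaller  : GR a b < c → Excuse a c b
  diagonal : ∀ i → i < a → GR (a ∸ suc i) (b ∸ suc i) ≡ c → Excuse a c b

excuse : ∀ {a c b} → a < b → (∀ b' → b' ≤ b → GR a b' ≢ c) → Excuse a c b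
excuse {a} {c} {b} a<b missed with <-cmp (GR a b) c
... | tri< GR<c _ _ = smaller GR<c
... | tri≈ _ GR≡c _ = ⊥-elim (missed b ≤-refl GR≡c)
... | tri> _ _ c<GR with below-GR-source a<b c<GR
...   | inj₁ (b' , b'<b , hit) = ⊥-elim (missed b' (<⇒≤ b'<b) hit)
...   | inj₂ (i , i<a , hit) = diagonal i i<a hit

code : ∀ {a c b} → Excuse a c b → ℕ
code {a} {b = b} (smaller _) = GR a b
code {c = c} (diagonal i _ _) = c + i

code-< : ∀ {a c b} (e : Excuse a c b) → code e < c + a
code-< {c = c} (smaller GR<c) = <-≤-trans GR<c (m≤m+n c _)
code-< {c = c} (diagonal _ i<a _) = +-monoʳ-< c i<a

code-injective : ∀ {a c b₁ b₂} → a < b₁ → b₁ < b₂ →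
  (e₁ : Excuse a c b₁) (e₂ : Excuse a c b₂) → code e₁ ≢ code e₂
code-injective a<b₁ b₁<b₂ (smaller _) (smaller _) same =
  row-distinct (<⇒≤ (<-trans a<b₁ b₁<b₂)) b₁<b₂ same
code-injective {c = c} _ _ (smaller GR<c) (diagonal i _ _) same =
  <⇒≱ GR<c (subst (c ≤_) (sym same) (m≤m+n c i))
code-injective {c = c} _ _ (diagonal i _ _) (smaller GR<c) same =
  <⇒≱ GR<c (subst (c ≤_) same (m≤m+n c i))
code-injective {a} {c} {b₁} {b₂} a<b₁ b₁<b₂ (diagonal i i<a hit₁) (diagonal j _ hit₂) same
  with +-cancelˡ-≡ c i j same
... | refl = row-distinct {a ∸ suc i} {b₂ ∸ suc i} {b₁ ∸ suc i}
                         (∸-monoˡ-≤ (suc i) (<⇒≤ (<-trans a<b₁ b₁<b₂)))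
                         (∸-monoˡ-< b₁<b₂ (<-trans i<a a<b₁))
                         (trans hit₁ (sym hit₂))

search-bound : ℕ → ℕ → ℕ
search-bound a c = suc a + (c + a)

-- Row a attains c by column search-bound a c: otherwise the c + a + 1 columns
-- a < b ≤ search-bound a c would carry excuses with c + a + 1 distinct codes below c + a.
row-attains : ∀ a c → ¬ (∀ b → b ≤ search-bound a c → GR a b ≢ c)
row-attains a c missed = collision (pigeonhole ≤-refl coded)
  where
  column : Fin (suc (c + a)) → ℕ
  column k = suc a + toℕ k

  above : ∀ k → a < column k
  above k = s≤s (m≤m+n a (toℕ k))

  excuse-at : ∀ k → Excuse a c (column k)
  excuse-at k = excuse (above k) λ b b≤ →
    missed b (≤-trans b≤ (+-monoʳ-≤ (suc a) (s≤s⁻¹ (toℕ<n k))))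

  coded : Fin (suc (c + a)) → Fin (c + a)
  coded k = fromℕ< (code-< (excuse-at k))

  collision : (∃₂ λ i j → i Fin.< j × coded i ≡ coded j) → ⊥
  collision (i , j , i<j , same) =
    code-injective (above i) (+-monoʳ-< (suc a) i<j) (excuse-at i) (excuse-at j)
      (trans (sym (toℕ-fromℕ< _)) (trans (cong toℕ same) (toℕ-fromℕ< _)))

theorem2p7 : (a c : ℕ) → ∃ (λ b → GR a b ≡ c)
theorem2p7 a c with any? (λ (k : Fin (suc (search-bound a c))) → GR a (toℕ k) ≟ c)
... | yes (k , hit) = toℕ k , hit
... | no none = ⊥-elim (row-attains a c λ b b≤ hit →
  none (fromℕ< (s≤s b≤) , subst (λ y → GR a y ≡ c) (sym (toℕ-fromℕ< (s≤s b≤))) hit))
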